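{- As formal power series in $z$, $$\sum_{n=0}^\infty \widehat{B}_{n}(x)\frac{z^n}{n!}=\frac{x-1}{(x-1)\cos(z(x-1))-(x+1)\sin(z(x-1))}.$$
   Context: Let $\mathcal{S}^B_n$ be the set of signed permutations $\sigma$ of $\{\pm1,\dots,\pm n\}$ with $\sigma(-i)=-\sigma(i)$, written as $\sigma(0)\sigma(1)\cdots\sigma(n)$ with $\sigma(0)=0$. A position $j\in\{0,\dots,n-1\}$ is an alternating descent of $\sigma$ if $j$ is even and $\sigma(j)<\sigma(j+1)$, or $j$ is odd and $\sigma(j)>\sigma(j+1)$; ${\rm altdes}_B(\sigma)$ is their number. $\widehat{B}_n(x)=\sum_{\sigma\in\mathcal{S}^B_n}x^{{\rm altdes}_B(\sigma)}$, with $\widehat B_0(x)=1$. -}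

module Defs where

open import Data.Bool using (Bool; true; false; not; _∧_; _∨_; if_then_else_)
open import Data.Nat as ℕ using (ℕ; zero; suc; _≡ᵇ_)
open import Data.Nat.Combinatorics using (_C_)
open import Data.Integer as ℤ using (ℤ; +_; -_; _+_; _-_; _*_; _^_; ∣_∣; _<?_; 0ℤ; 1ℤ)
open import Relation.Nullary using (does)
open import Data.List using (List; []; _∷_; map; _++_; concatMap; foldr; upTo)

boolFilter : {A : Set} → (A → Bool) → List A → List A
boolFilter f [] = []
boolFilter f (a ∷ as) = if f a then a ∷ boolFilter f as else boolFilter f as

sumℤ : List ℤ → ℤ
sumℤ = foldr _+_ 0ℤ

elemℕ : ℕ → List ℕ → Bool
elemℕ a []       = false
elemℕ a (b ∷ bs) = (a ≡ᵇ b) ∨ elemℕ a bs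

distinctℕ : List ℕ → Bool
distinctℕ []       = true
distinctℕ (a ∷ as) = not (elemℕ a as) ∧ distinctℕ as

alphabet : ℕ → List ℤ
alphabet n = map (λ k → + suc k) (upTo n) ++ map (λ k → - (+ suc k)) (upTo n)

words : {A : Set} → ℕ → List A → List (List A)
words zero    L = [] ∷ []
words (suc m) L = concatMap (λ a → map (a ∷_) (words m L)) L

-- A signed permutation σ ∈ S^B_n is identified with the word σ(1)σ(2)…σ(n):
-- letters in {±1,…,±n} whose absolute values are pairwise distinct
-- (σ(-i) = -σ(i) and σ(0)=0 determine the rest).
-- Each signed permutation occurs exactly once in this list.
signedPerms : ℕ → List (List ℤ)
signedPerms n = boolFilter (λ w → distinctℕ (map ∣_∣ w)) (words n (alphabet n))

-- alternating descents of σ(0)σ(1)…σ(n) with σ(0)=0.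
-- The flag is true iff the current position j (of the left letter) is even.
altdesAux : Bool → ℤ → List ℤ → ℕ
altdesAux ev p []       = 0
altdesAux ev p (y ∷ ys) =
  (if (if ev then does (p <? y) else does (y <? p)) then 1 else 0) ℕ.+ altdesAux (not ev) y ys

altdesB : List ℤ → ℕ
altdesB w = altdesAux true 0ℤ w

-- \widehat{B}_n(x) evaluated at an integer x
Bhat : ℕ → ℤ → ℤ
Bhat n x = sumℤ (map (λ w → x ^ altdesB w) (signedPerms n))

-- m-th derivative at 0 of cos and sin:  cos z = Σ cosCoef m z^m/m!, etc.
cosCoef : ℕ → ℤ
cosCoef 0 = 1ℤ
cosCoef 1 = 0ℤ
cosCoef 2 = - 1ℤ
cosCoef 3 = 0ℤ
cosCoef (suc (suc (suc (suc m)))) = cosCoef m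

sinCoef : ℕ → ℤ
sinCoef 0 = 0ℤ
sinCoef 1 = 1ℤ
sinCoef 2 = 0ℤ
sinCoef 3 = - 1ℤ
sinCoef (suc (suc (suc (suc m)))) = sinCoef m

-- D(z) = (x-1) cos(z(x-1)) - (x+1) sin(z(x-1)) = Σ_m denomCoef m x · z^m/m!
denomCoef : ℕ → ℤ → ℤ
denomCoef m x =
  (x - 1ℤ) * ((x - 1ℤ) ^ m) * cosCoef m - (x + 1ℤ) * ((x - 1ℤ) ^ m) * sinCoef m

-- n!·[z^n] of (Σ_k Bhat k x z^k/k!) · D(z)   (EGF product = binomial convolution)
prodCoef : ℕ → ℤ → ℤ
prodCoef n x = sumℤ (map (λ k → (+ (n C k)) * Bhat k x * denomCoef (n ℕ.∸ k) x) (upTo (suc n)))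

-- n!·[z^n] of the constant series x-1
numCoef : ℕ → ℤ → ℤ
numCoef zero    x = x - 1ℤ
numCoef (suc n) x = 0ℤ

-- The weighted sum over all completions of a prefix ending in the letter p depends only on the
-- parity of the position of p and on the number r of unused letters above p.  Summing over the
-- next letter gives a recursion for these polynomials, A (even position) and B (odd position),
-- with B̂_n(x) = A_n(n).  Raising r by one turns exactly one weight 1 into x, so consecutive
-- values of A_N differ by (x−1)·B_{N−1}; negating letters gives B_N(r) = A_N(2N − r); and
-- A_N(2N) = x·A_N(0).  With y = x − 1 and f(t) = A_t(t), induction on s then gives
-- A_N(N ± s) = Σ_k C(s,k) y^k (c_k ± s_k) f(N − k), where c_k, s_k are the derivatives of cos
-- and sin at 0.  For s = N the relation A_N(2N) = x·A_N(0) says exactly that the coefficient of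
-- z^N, N ≥ 1, of (Σ B̂_n z^n/n!)·((x−1)cos(yz) − (x+1)sin(yz)) vanishes.

module Submission where

open import Defs
open import Data.Bool using (Bool; true; false; not; _∧_; if_then_else_)
open import Data.Bool.ListAction using (all)
open import Data.Bool.Properties using (T-≡; not-injective)
open import Data.Nat as ℕ using (ℕ; zero; suc; _≡ᵇ_; _∸_; z≤n; s≤s)
import Data.Nat.Properties as ℕP
open import Data.Nat.Combinatorics using (_C_; nCk≡nC[n∸k]; nCk+nC[k+1]≡[n+1]C[k+1]; k>n⇒nCk≡0)
open import Data.Integer as ℤ using (ℤ; +_; -_; -[1+_]; ∣_∣; _+_; _-_; _*_; _^_; _<?_; 0ℤ; 1ℤ)
import Data.Integer.Properties as ℤP
open import Data.Integer.Tactic.RingSolver using (solve-∀)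
open import Data.List using (List; []; _∷_; map; _++_; concatMap; length; applyUpTo; upTo)
open import Data.List.Properties using (map-++; map-∘; map-cong; concatMap-cong; length-upTo)
import Data.List.Relation.Unary.AllPairs.Properties as AllPairs
open import Data.List.Relation.Unary.All using (All; []; _∷_)
import Data.List.Relation.Unary.All as All
open import Data.List.Relation.Unary.AllPairs using (AllPairs; []; _∷_)
open import Data.List.Relation.Unary.Any using (here; there)
open import Data.List.Membership.Propositional using (_∈_; _∉_)
open import Data.List.Membership.Propositional.Properties using (∈-map⁺; ∈-map⁻; ∈-++⁺ˡ; ∈-++⁺ʳ; ∈-++⁻)
open import Data.Product using (_×_; _,_; proj₁; proj₂)
open import Data.Sum using (inj₁; inj₂)
open import Function using (_∘_; _⇔_; mk⇔; Equivalence)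
open import Relation.Nullary using (does; yes; no; contradiction)
open import Relation.Nullary.Decidable using (dec-true; dec-false; does-⇔; ¬?)
open import Relation.Binary using (tri<; tri≈; tri>)
open import Relation.Binary.PropositionalEquality

sumℤ-++ : ∀ xs ys → sumℤ (xs ++ ys) ≡ sumℤ xs + sumℤ ys
sumℤ-++ []       ys = sym (ℤP.+-identityˡ _)
sumℤ-++ (x ∷ xs) ys = trans (cong (_+_ x) (sumℤ-++ xs ys)) (sym (ℤP.+-assoc x _ _))

sumℤ-map-*ˡ : {A : Set} (c : ℤ) (g : A → ℤ) (ws : List A) →
              sumℤ (map (λ w → c * g w) ws) ≡ c * sumℤ (map g ws)
sumℤ-map-*ˡ c g []       = sym (ℤP.*-zeroʳ c)
sumℤ-map-*ˡ c g (w ∷ ws) =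
  trans (cong (_+_ (c * g w)) (sumℤ-map-*ˡ c g ws)) (sym (ℤP.*-distribˡ-+ c (g w) _))

sumℤ-concatMap : {A B : Set} (h : B → ℤ) (g : A → List B) (as : List A) →
                 sumℤ (map h (concatMap g as)) ≡ sumℤ (map (λ a → sumℤ (map h (g a))) as)
sumℤ-concatMap h g []       = refl
sumℤ-concatMap h g (a ∷ as) = begin
  sumℤ (map h (g a ++ concatMap g as))                ≡⟨ cong sumℤ (map-++ h (g a) _) ⟩
  sumℤ (map h (g a) ++ map h (concatMap g as))        ≡⟨ sumℤ-++ (map h (g a)) _ ⟩
  sumℤ (map h (g a)) + sumℤ (map h (concatMap g as))
    ≡⟨ cong (_+_ (sumℤ (map h (g a)))) (sumℤ-concatMap h g as) ⟩
  sumℤ (map h (g a)) + sumℤ (map (λ a → sumℤ (map h (g a))) as) ∎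
  where open ≡-Reasoning

module _ {A : Set} where

  boolFilter-++ : (f : A → Bool) (xs ys : List A) →
                  boolFilter f (xs ++ ys) ≡ boolFilter f xs ++ boolFilter f ys
  boolFilter-++ f []       ys = refl
  boolFilter-++ f (x ∷ xs) ys with f x
  ... | true  = cong (x ∷_) (boolFilter-++ f xs ys)
  ... | false = boolFilter-++ f xs ys

  boolFilter-cong : {f g : A → Bool} (ws : List A) → (∀ w → f w ≡ g w) →
                    boolFilter f ws ≡ boolFilter g ws
  boolFilter-cong [] e = refl
  boolFilter-cong {g = g} (w ∷ ws) e rewrite e w with g w
  ... | true  = cong (w ∷_) (boolFilter-cong ws e)
  ... | false = boolFilter-cong ws e

  boolFilter-∧ : (f g : A → Bool) (ws : List A) →
                 boolFilter (λ w → f w ∧ g w) ws ≡ boolFilter g (boolFilter f ws)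
  boolFilter-∧ f g []       = refl
  boolFilter-∧ f g (w ∷ ws) with f w
  ... | false = boolFilter-∧ f g ws
  ... | true with g w
  ...   | true  = cong (w ∷_) (boolFilter-∧ f g ws)
  ...   | false = boolFilter-∧ f g ws

  boolFilter-concatMap : {B : Set} (f : A → Bool) (g : B → List A) (bs : List B) →
                         boolFilter f (concatMap g bs) ≡ concatMap (boolFilter f ∘ g) bs
  boolFilter-concatMap f g []       = refl
  boolFilter-concatMap f g (b ∷ bs) =
    trans (boolFilter-++ f (g b) _) (cong (boolFilter f (g b) ++_) (boolFilter-concatMap f g bs))

  concatMap-boolFilter : {B : Set} (f : A → Bool) (g : A → List B) (as : List A) →
                         concatMap g (boolFilter f as) ≡ concatMap (λ a → if f a then g a else []) as
  concatMap-boolFilter f g []       = refl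
  concatMap-boolFilter f g (a ∷ as) with f a
  ... | true  = cong (g a ++_) (concatMap-boolFilter f g as)
  ... | false = concatMap-boolFilter f g as

boolFilter-map : {A B : Set} (f : B → Bool) (h : A → B) (ws : List A) →
                 boolFilter f (map h ws) ≡ map h (boolFilter (f ∘ h) ws)
boolFilter-map f h []       = refl
boolFilter-map f h (w ∷ ws) with f (h w)
... | true  = cong (h w ∷_) (boolFilter-map f h ws)
... | false = boolFilter-map f h ws

boolFilter-all-cons : {A : Set} (P : A → Bool) (a : A) (ws : List (List A)) →
  boolFilter (all P) (map (a ∷_) ws) ≡ (if P a then map (a ∷_) (boolFilter (all P) ws) else [])
boolFilter-all-cons P a [] with P a
... | true  = refl
... | false = refl
boolFilter-all-cons P a (w ∷ ws) with P a | boolFilter-all-cons P a ws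
... | false | ih = ih
... | true  | ih with all P w
...   | true  = cong ((a ∷ w) ∷_) ih
...   | false = ih

boolFilter-all-words : {A : Set} (P : A → Bool) (m : ℕ) (L : List A) →
                       boolFilter (all P) (words m L) ≡ words m (boolFilter P L)
boolFilter-all-words P zero    L = refl
boolFilter-all-words P (suc m) L = begin
  boolFilter (all P) (concatMap (λ a → map (a ∷_) (words m L)) L)
    ≡⟨ boolFilter-concatMap (all P) _ L ⟩
  concatMap (λ a → boolFilter (all P) (map (a ∷_) (words m L))) L
    ≡⟨ concatMap-cong (λ a → trans (boolFilter-all-cons P a (words m L))
                          (cong (λ ws → if P a then map (a ∷_) ws else []) (boolFilter-all-words P m L))) L ⟩
  concatMap (λ a → if P a then map (a ∷_) (words m (boolFilter P L)) else []) L
    ≡⟨ concatMap-boolFilter P _ L ⟨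
  concatMap (λ a → map (a ∷_) (words m (boolFilter P L))) (boolFilter P L) ∎
  where open ≡-Reasoning

distinctAbs : List ℤ → Bool
distinctAbs w = distinctℕ (map ∣_∣ w)

differentAbs : ℤ → ℤ → Bool
differentAbs a b = not (∣ a ∣ ≡ᵇ ∣ b ∣)

distinctAbsWords : ℕ → List ℤ → List (List ℤ)
distinctAbsWords m L = boolFilter distinctAbs (words m L)

not-elemℕ-abs : ∀ a w → not (elemℕ ∣ a ∣ (map ∣_∣ w)) ≡ all (differentAbs a) w
not-elemℕ-abs a []      = refl
not-elemℕ-abs a (b ∷ w) with ∣ a ∣ ≡ᵇ ∣ b ∣
... | true  = refl
... | false = not-elemℕ-abs a w

distinctAbs-cons-words : ∀ a m L →
  boolFilter distinctAbs (map (a ∷_) (words m L))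
    ≡ map (a ∷_) (distinctAbsWords m (boolFilter (differentAbs a) L))
distinctAbs-cons-words a m L = begin
  boolFilter distinctAbs (map (a ∷_) (words m L))
    ≡⟨ boolFilter-map distinctAbs (a ∷_) (words m L) ⟩
  map (a ∷_) (boolFilter (λ w → not (elemℕ ∣ a ∣ (map ∣_∣ w)) ∧ distinctAbs w) (words m L))
    ≡⟨ cong (map (a ∷_)) (boolFilter-cong (words m L) (λ w → cong (_∧ distinctAbs w) (not-elemℕ-abs a w))) ⟩
  map (a ∷_) (boolFilter (λ w → all (differentAbs a) w ∧ distinctAbs w) (words m L))
    ≡⟨ cong (map (a ∷_)) (boolFilter-∧ (all (differentAbs a)) distinctAbs (words m L)) ⟩
  map (a ∷_) (boolFilter distinctAbs (boolFilter (all (differentAbs a)) (words m L)))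
    ≡⟨ cong (map (a ∷_) ∘ boolFilter distinctAbs) (boolFilter-all-words (differentAbs a) m L) ⟩
  map (a ∷_) (distinctAbsWords m (boolFilter (differentAbs a) L)) ∎
  where open ≡-Reasoning

distinctAbsWords-suc : ∀ m L → distinctAbsWords (suc m) L
  ≡ concatMap (λ a → map (a ∷_) (distinctAbsWords m (boolFilter (differentAbs a) L))) L
distinctAbsWords-suc m L = trans (boolFilter-concatMap distinctAbs _ L)
                                 (concatMap-cong (λ a → distinctAbs-cons-words a m L) L)

-- Ranks among signed letters

countᵇ : {A : Set} → (A → Bool) → List A → ℕ
countᵇ P []      = 0
countᵇ P (b ∷ L) = if P b then suc (countᵇ P L) else countᵇ P L

module _ {A : Set} where

  countᵇ-++ : (P : A → Bool) (xs ys : List A) → countᵇ P (xs ++ ys) ≡ countᵇ P xs ℕ.+ countᵇ P ys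
  countᵇ-++ P []       ys = refl
  countᵇ-++ P (b ∷ xs) ys with P b
  ... | true  = cong suc (countᵇ-++ P xs ys)
  ... | false = countᵇ-++ P xs ys

  countᵇ-cong : {P Q : A → Bool} (L : List A) → (∀ b → P b ≡ Q b) → countᵇ P L ≡ countᵇ Q L
  countᵇ-cong []      e = refl
  countᵇ-cong (b ∷ L) e rewrite e b = cong (λ c → if _ then suc c else c) (countᵇ-cong L e)

  countᵇ-all-true : {P : A → Bool} {L : List A} → All (λ b → P b ≡ true) L → countᵇ P L ≡ length L
  countᵇ-all-true []         = refl
  countᵇ-all-true (e ∷ es) rewrite e = cong suc (countᵇ-all-true es)

  countᵇ-all-false : {P : A → Bool} {L : List A} → All (λ b → P b ≡ false) L → countᵇ P L ≡ 0
  countᵇ-all-false []         = refl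
  countᵇ-all-false (e ∷ es) rewrite e = countᵇ-all-false es

  countᵇ-boolFilter : (P Q : A → Bool) → (∀ b → Q b ≡ false → P b ≡ false) →
                      ∀ L → countᵇ P (boolFilter Q L) ≡ countᵇ P L
  countᵇ-boolFilter P Q Q⇒P []      = refl
  countᵇ-boolFilter P Q Q⇒P (b ∷ L) with Q b in eq
  ... | true  = cong (λ c → if P b then suc c else c) (countᵇ-boolFilter P Q Q⇒P L)
  ... | false rewrite Q⇒P b eq = countᵇ-boolFilter P Q Q⇒P L

countᵇ-map : {A B : Set} (P : B → Bool) (f : A → B) (L : List A) →
             countᵇ P (map f L) ≡ countᵇ (P ∘ f) L
countᵇ-map P f []      = refl
countᵇ-map P f (a ∷ L) = cong (λ c → if P (f a) then suc c else c) (countᵇ-map P f L)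

countAbove : ℤ → List ℤ → ℕ
countAbove p = countᵇ (λ b → does (p <? b))

countAbove-antimono : ∀ {p a} L → p ℤ.≤ a → countAbove a L ℕ.≤ countAbove p L
countAbove-antimono []      p≤a = z≤n
countAbove-antimono {p} {a} (b ∷ L) p≤a with a <? b | p <? b
... | yes _   | yes _   = s≤s (countAbove-antimono L p≤a)
... | yes a<b | no p≮b  = contradiction (ℤP.≤-<-trans p≤a a<b) p≮b
... | no _    | yes _   = ℕP.m≤n⇒m≤1+n (countAbove-antimono L p≤a)
... | no _    | no _    = countAbove-antimono L p≤a

countAbove-strict : ∀ {p a} L → a ∈ L → p ℤ.< a → countAbove a L ℕ.< countAbove p L
countAbove-strict {p} {a} (b ∷ L) (here refl) p<a with a <? a | p <? a
... | yes a<a | _      = contradiction a<a (ℤP.<-irrefl refl)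
... | no _    | yes _  = s≤s (countAbove-antimono L (ℤP.<⇒≤ p<a))
... | no _    | no p≮a = contradiction p<a p≮a
countAbove-strict {p} {a} (b ∷ L) (there a∈L) p<a with a <? b | p <? b
... | yes _   | yes _  = s≤s (countAbove-strict L a∈L p<a)
... | yes a<b | no p≮b = contradiction (ℤP.<-trans p<a a<b) p≮b
... | no _    | yes _  = ℕP.m≤n⇒m≤1+n (countAbove-strict L a∈L p<a)
... | no _    | no _   = countAbove-strict L a∈L p<a

<⇔countAbove> : ∀ {p a L} → a ∈ L → p ∉ L → p ℤ.< a ⇔ countAbove a L ℕ.< countAbove p L
<⇔countAbove> {p} {a} {L} a∈L p∉L = mk⇔ (countAbove-strict L a∈L) from
  where
  from : countAbove a L ℕ.< countAbove p L → p ℤ.< a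
  from lt with ℤP.<-cmp p a
  ... | tri< p<a _ _ = p<a
  ... | tri≈ _ refl _ = contradiction a∈L p∉L
  ... | tri> _ _ a<p = contradiction (countAbove-antimono L (ℤP.<⇒≤ a<p)) (ℕP.<⇒≱ lt)

does-<?-flip : ∀ a p → a ≢ p → does (a <? p) ≡ not (does (p <? a))
does-<?-flip a p a≢p with ℤP.<-cmp a p
... | tri< a<p _ _   = trans (dec-true (a <? p) a<p) (sym (cong not (dec-false (p <? a) (ℤP.<-asym a<p))))
... | tri≈ _ a≡p _   = contradiction a≡p a≢p
... | tri> a≮p _ p<a = trans (dec-false (a <? p) a≮p) (sym (cong not (dec-true (p <? a) p<a)))

isAltDescent : Bool → Bool → Bool
isAltDescent even rises = if even then rises else not rises

isAltDescentStep : Bool → ℤ → ℤ → Bool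
isAltDescentStep even p a = if even then does (p <? a) else does (a <? p)

isAltDescentStep-by-rank : ∀ even {p a L} → a ∈ L → p ∉ L →
  isAltDescentStep even p a ≡ isAltDescent even (does (countAbove a L ℕ.<? countAbove p L))
isAltDescentStep-by-rank true  {p} {a} {L} a∈L p∉L =
  does-⇔ (<⇔countAbove> a∈L p∉L) (p <? a) (countAbove a L ℕ.<? countAbove p L)
isAltDescentStep-by-rank false {p} {a} {L} a∈L p∉L =
  trans (does-<?-flip a p (λ { refl → p∉L a∈L }))
        (cong not (isAltDescentStep-by-rank true a∈L p∉L))

signedLetters : List ℕ → List ℤ
signedLetters S = map (λ k → + suc k) S ++ map (λ k → -[1+ k ]) S

remove : ℕ → List ℕ → List ℕ
remove s = boolFilter (λ t → not (s ≡ᵇ t))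

countGreater countLess : ℕ → List ℕ → ℕ
countGreater s = countᵇ (λ t → does (s ℕ.<? t))
countLess    s = countᵇ (λ t → does (t ℕ.<? s))

countAbove-pos : ∀ s S → countAbove (+ suc s) (signedLetters S) ≡ countGreater s S
countAbove-pos s S = begin
  countAbove (+ suc s) (signedLetters S)
    ≡⟨ countᵇ-++ _ (map (λ k → + suc k) S) _ ⟩
  countAbove (+ suc s) (map (λ k → + suc k) S) ℕ.+ countAbove (+ suc s) (map (λ k → -[1+ k ]) S)
    ≡⟨ cong₂ ℕ._+_ (trans (countᵇ-map _ (λ k → + suc k) S) (countᵇ-cong S compare))
                   (trans (countᵇ-map _ (λ k → -[1+ k ]) S) (countᵇ-all-false (All.universal (λ t → refl) S))) ⟩
  countGreater s S ℕ.+ 0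
    ≡⟨ ℕP.+-identityʳ _ ⟩
  countGreater s S ∎
  where
  open ≡-Reasoning
  compare : ∀ t → does (+ suc s <? + suc t) ≡ does (s ℕ.<? t)
  compare t = does-⇔ (mk⇔ (ℕ.s<s⁻¹ ∘ ℤP.drop‿+<+) (ℤ.+<+ ∘ ℕ.s<s)) (+ suc s <? + suc t) (s ℕ.<? t)

countAbove-neg : ∀ s S → countAbove -[1+ s ] (signedLetters S) ≡ length S ℕ.+ countLess s S
countAbove-neg s S = trans (countᵇ-++ _ (map (λ k → + suc k) S) _) (cong₂ ℕ._+_
  (trans (countᵇ-map _ (λ k → + suc k) S) (countᵇ-all-true (All.universal (λ t → refl) S)))
  (trans (countᵇ-map _ (λ k → -[1+ k ]) S)
         (countᵇ-cong S (λ t → does-⇔ (mk⇔ ℤP.drop‿-<- ℤ.-<-) (-[1+ s ] <? -[1+ t ]) (t ℕ.<? s)))))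

countAbove-zero : ∀ S → countAbove 0ℤ (signedLetters S) ≡ length S
countAbove-zero S = trans (countᵇ-++ _ (map (λ k → + suc k) S) _) (trans (cong₂ ℕ._+_
  (trans (countᵇ-map _ (λ k → + suc k) S) (countᵇ-all-true (All.universal (λ t → refl) S)))
  (trans (countᵇ-map _ (λ k → -[1+ k ]) S) (countᵇ-all-false (All.universal (λ t → refl) S))))
  (ℕP.+-identityʳ _))

≡ᵇ-refl : ∀ s → (s ≡ᵇ s) ≡ true
≡ᵇ-refl s = Equivalence.to T-≡ (ℕP.≡⇒≡ᵇ s s refl)

≡ᵇ-true⇒≡ : ∀ {s t} → (s ≡ᵇ t) ≡ true → s ≡ t
≡ᵇ-true⇒≡ {s} {t} e = ℕP.≡ᵇ⇒≡ s t (Equivalence.from T-≡ e)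

removed⇒≡ : ∀ {s t} → not (s ≡ᵇ t) ≡ false → s ≡ t
removed⇒≡ e = ≡ᵇ-true⇒≡ (not-injective e)

∈-boolFilter⁻ : {A : Set} (P : A → Bool) {t : A} (S : List A) → t ∈ boolFilter P S → P t ≡ true
∈-boolFilter⁻ P (u ∷ S) t∈ with P u in e
∈-boolFilter⁻ P (u ∷ S) (here refl) | true = e
∈-boolFilter⁻ P (u ∷ S) (there t∈)  | true = ∈-boolFilter⁻ P S t∈
∈-boolFilter⁻ P (u ∷ S) t∈          | false = ∈-boolFilter⁻ P S t∈

∉-remove : ∀ s S → s ∉ remove s S
∉-remove s S s∈ with trans (sym (cong not (≡ᵇ-refl s))) (∈-boolFilter⁻ _ S s∈)
... | ()

countGreater-remove : ∀ s S → countGreater s (remove s S) ≡ countGreater s S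
countGreater-remove s = countᵇ-boolFilter _ _ (λ t e → dec-false (s ℕ.<? t) (ℕP.<-irrefl (removed⇒≡ e)))

countLess-remove : ∀ s S → countLess s (remove s S) ≡ countLess s S
countLess-remove s = countᵇ-boolFilter _ _ (λ t e → dec-false (t ℕ.<? s) (ℕP.<-irrefl (sym (removed⇒≡ e))))

module _ {A : Set} {R : A → A → Set} where

  All-boolFilter : ∀ {Q : A → Set} (P : A → Bool) {S} → All Q S → All Q (boolFilter P S)
  All-boolFilter P [] = []
  All-boolFilter P {t ∷ S} (q ∷ qs) with P t
  ... | true  = q ∷ All-boolFilter P qs
  ... | false = All-boolFilter P qs

  AllPairs-boolFilter : ∀ (P : A → Bool) {S} → AllPairs R S → AllPairs R (boolFilter P S)
  AllPairs-boolFilter P [] = []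
  AllPairs-boolFilter P {t ∷ S} (r ∷ rs) with P t
  ... | true  = All-boolFilter P r ∷ AllPairs-boolFilter P rs
  ... | false = AllPairs-boolFilter P rs

remove-above : ∀ s {S} → All (s ℕ.<_) S → remove s S ≡ S
remove-above s []                 = refl
remove-above s {t ∷ S} (s<t ∷ s<S) with s ≡ᵇ t in e
... | true  = contradiction (≡ᵇ-true⇒≡ e) (ℕP.<⇒≢ s<t)
... | false = cong (t ∷_) (remove-above s s<S)

length-remove : ∀ {s S} → AllPairs ℕ._<_ S → s ∈ S → suc (length (remove s S)) ≡ length S
length-remove {s} (s<S ∷ _) (here refl) rewrite ≡ᵇ-refl s | remove-above s s<S = refl
length-remove {s} {t ∷ S} (t<S ∷ sorted) (there s∈S) with s ≡ᵇ t in e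
... | true  = contradiction (≡ᵇ-true⇒≡ e) (ℕP.>⇒≢ (All.lookup t<S s∈S))
... | false = cong suc (length-remove sorted s∈S)

pos-∈-signedLetters : ∀ {s S} → s ∈ S → + suc s ∈ signedLetters S
pos-∈-signedLetters s∈S = ∈-++⁺ˡ (∈-map⁺ _ s∈S)

neg-∈-signedLetters : ∀ {s S} → s ∈ S → -[1+ s ] ∈ signedLetters S
neg-∈-signedLetters {S = S} s∈S = ∈-++⁺ʳ (map (λ k → + suc k) S) (∈-map⁺ _ s∈S)

∉-signedLetters : ∀ {b S} → (∀ t → ∣ b ∣ ≡ suc t → t ∉ S) → b ∉ signedLetters S
∉-signedLetters {S = S} t∉S b∈ with ∈-++⁻ (map (λ k → + suc k) S) b∈
... | inj₁ b∈pos with ∈-map⁻ _ b∈pos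
...   | t , t∈S , refl = t∉S t refl t∈S
∉-signedLetters {S = S} t∉S b∈ | inj₂ b∈neg with ∈-map⁻ _ b∈neg
...   | t , t∈S , refl = t∉S t refl t∈S

zero-∉-signedLetters : ∀ S → 0ℤ ∉ signedLetters S
zero-∉-signedLetters S = ∉-signedLetters {S = S} (λ t ())

boolFilter-differentAbs : ∀ {b k} S → ∣ b ∣ ≡ suc k →
  boolFilter (differentAbs b) (signedLetters S) ≡ signedLetters (remove k S)
boolFilter-differentAbs {b} {k} S e = trans (boolFilter-++ (differentAbs b) (map (λ t → + suc t) S) _)
  (cong₂ _++_ (trans (boolFilter-map _ (λ t → + suc t) S) (cong (map _) (boolFilter-cong S same)))
              (trans (boolFilter-map _ (λ t → -[1+ t ]) S) (cong (map _) (boolFilter-cong S same))))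
  where
  same : ∀ t → not (∣ b ∣ ≡ᵇ suc t) ≡ not (k ≡ᵇ t)
  same t = cong (λ n → not (n ≡ᵇ suc t)) e

∑ : (ℕ → ℤ) → ℕ → ℤ
∑ g zero    = 0ℤ
∑ g (suc n) = g 0 + ∑ (g ∘ suc) n

∑-suc : ∀ g n → ∑ g (suc n) ≡ ∑ g n + g n
∑-suc g zero    = trans (ℤP.+-identityʳ (g 0)) (sym (ℤP.+-identityˡ (g 0)))
∑-suc g (suc n) = trans (cong (_+_ (g 0)) (∑-suc (g ∘ suc) n)) (sym (ℤP.+-assoc (g 0) _ _))

∑-cong : ∀ {g h} n → (∀ j → j ℕ.< n → g j ≡ h j) → ∑ g n ≡ ∑ h n
∑-cong zero    e = refl
∑-cong (suc n) e = cong₂ _+_ (e 0 (s≤s z≤n)) (∑-cong n (λ j j<n → e (suc j) (s≤s j<n)))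

sumℤ-applyUpTo : ∀ (h : ℕ → ℤ) g n → sumℤ (map h (applyUpTo g n)) ≡ ∑ (h ∘ g) n
sumℤ-applyUpTo h g zero    = refl
sumℤ-applyUpTo h g (suc n) = cong (_+_ (h (g 0))) (sumℤ-applyUpTo h (g ∘ suc) n)

∑-+ : ∀ g h n → ∑ (λ k → g k + h k) n ≡ ∑ g n + ∑ h n
∑-+ g h zero    = refl
∑-+ g h (suc n) = trans (cong (_+_ (g 0 + h 0)) (∑-+ (g ∘ suc) (h ∘ suc) n))
                        (interchange (g 0) (h 0) (∑ (g ∘ suc) n) (∑ (h ∘ suc) n))
  where
  interchange : ∀ a b c d → (a + b) + (c + d) ≡ (a + c) + (b + d)
  interchange = solve-∀

∑-*ˡ : ∀ c g n → ∑ (λ k → c * g k) n ≡ c * ∑ g n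
∑-*ˡ c g zero    = sym (ℤP.*-zeroʳ c)
∑-*ˡ c g (suc n) = trans (cong (_+_ (c * g 0)) (∑-*ˡ c (g ∘ suc) n)) (sym (ℤP.*-distribˡ-+ c (g 0) _))

∑-reverse : ∀ g m → ∑ g (suc m) ≡ ∑ (λ j → g (m ∸ j)) (suc m)
∑-reverse g zero    = refl
∑-reverse g (suc m) = begin
  g 0 + ∑ (g ∘ suc) (suc m)
    ≡⟨ cong (_+_ (g 0)) (∑-reverse (g ∘ suc) m) ⟩
  g 0 + ∑ (λ j → g (suc (m ∸ j))) (suc m)
    ≡⟨ ℤP.+-comm (g 0) _ ⟩
  ∑ (λ j → g (suc (m ∸ j))) (suc m) + g 0
    ≡⟨ cong₂ _+_ (∑-cong (suc m) (λ j j<1+m → cong g (sym (ℕP.+-∸-assoc 1 (ℕ.s≤s⁻¹ j<1+m)))))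
                 (cong g (sym (ℕP.n∸n≡0 m))) ⟩
  ∑ (λ j → g (suc m ∸ j)) (suc m) + g (suc m ∸ suc m)
    ≡⟨ ∑-suc (λ j → g (suc m ∸ j)) (suc m) ⟨
  ∑ (λ j → g (suc m ∸ j)) (suc (suc m)) ∎
  where open ≡-Reasoning

∑-Pascal : ∀ s (h : ℕ → ℤ) → ∑ (λ k → + (suc s C k) * h k) (suc (suc s))
         ≡ ∑ (λ k → + (s C k) * h k) (suc s) + ∑ (λ k → + (s C k) * h (suc k)) (suc s)
∑-Pascal s h = begin
  1ℤ * h 0 + ∑ (λ k → + (suc s C suc k) * h (suc k)) (suc s)
    ≡⟨ cong (_+_ (1ℤ * h 0)) (∑-cong (suc s) (λ k _ → pascal k)) ⟩
  1ℤ * h 0 + ∑ (λ k → + (s C k) * h (suc k) + + (s C suc k) * h (suc k)) (suc s)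
    ≡⟨ cong (_+_ (1ℤ * h 0)) (∑-+ (λ k → + (s C k) * h (suc k)) (λ k → + (s C suc k) * h (suc k)) (suc s)) ⟩
  1ℤ * h 0 + (shifted + ∑ (λ k → + (s C suc k) * h (suc k)) (suc s))
    ≡⟨ cong (λ t → 1ℤ * h 0 + (shifted + t)) (∑-suc (λ k → + (s C suc k) * h (suc k)) s) ⟩
  1ℤ * h 0 + (shifted + (∑ (λ k → + (s C suc k) * h (suc k)) s + + (s C suc s) * h (suc s)))
    ≡⟨ cong (λ c → 1ℤ * h 0 + (shifted + (∑ (λ k → + (s C suc k) * h (suc k)) s + + c * h (suc s))))
            (k>n⇒nCk≡0 (ℕP.n<1+n s)) ⟩
  1ℤ * h 0 + (shifted + (∑ (λ k → + (s C suc k) * h (suc k)) s + 0ℤ * h (suc s)))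
    ≡⟨ rearrange (1ℤ * h 0) shifted _ (h (suc s)) ⟩
  (1ℤ * h 0 + ∑ (λ k → + (s C suc k) * h (suc k)) s) + shifted ∎
  where
  open ≡-Reasoning
  shifted = ∑ (λ k → + (s C k) * h (suc k)) (suc s)
  pascal : ∀ k → + (suc s C suc k) * h (suc k) ≡ + (s C k) * h (suc k) + + (s C suc k) * h (suc k)
  pascal k = trans (cong (λ c → + c * h (suc k)) (sym (nCk+nC[k+1]≡[n+1]C[k+1] s k)))
                   (ℤP.*-distribʳ-+ (h (suc k)) (+ (s C k)) (+ (s C suc k)))
  rearrange : ∀ a b c d → a + (b + (c + 0ℤ * d)) ≡ (a + c) + b
  rearrange = solve-∀

does-+-<? : ∀ n j r → does (n ℕ.+ j ℕ.<? r) ≡ does (j ℕ.<? r ∸ n)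
does-+-<? zero    j r       = refl
does-+-<? (suc n) j zero    = refl
does-+-<? (suc n) j (suc r) = does-+-<? n j r

does-<?-complement : ∀ r s c u → r ℕ.+ s ≡ suc (c ℕ.+ u) → does (c ℕ.<? s) ≡ not (does (u ℕ.<? r))
does-<?-complement r s c u e =
  does-⇔ (mk⇔ (ℕP.≤⇒≯ ∘ to) (from ∘ ℕP.≮⇒≥)) (c ℕ.<? s) (¬? (u ℕ.<? r))
  where
  e′ : r ℕ.+ suc c ≡ suc (c ℕ.+ r)
  e′ = trans (ℕP.+-suc r c) (cong suc (ℕP.+-comm r c))
  to : c ℕ.< s → r ℕ.≤ u
  to c<s = ℕP.+-cancelˡ-≤ c r u (ℕ.s≤s⁻¹ (subst₂ ℕ._≤_ e′ e (ℕP.+-monoʳ-≤ r c<s)))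
  from : r ℕ.≤ u → c ℕ.< s
  from r≤u = ℕP.+-cancelˡ-≤ r (suc c) s (subst₂ ℕ._≤_ (sym e′) (sym e) (s≤s (ℕP.+-monoʳ-≤ c r≤u)))

-- The smallest element has every other one above it and is summed last.
sumℤ-by-countGreater : ∀ {S} → AllPairs ℕ._<_ S → (f g : ℕ → ℤ) →
  (∀ s → s ∈ S → f s ≡ g (countGreater s S)) → sumℤ (map f S) ≡ ∑ g (length S)
sumℤ-by-countGreater [] f g e = refl
sumℤ-by-countGreater {s₀ ∷ S} (s₀<S ∷ sorted) f g e = begin
  f s₀ + sumℤ (map f S)          ≡⟨ cong₂ _+_ first rest ⟩
  g (length S) + ∑ g (length S)  ≡⟨ ℤP.+-comm (g (length S)) _ ⟩
  ∑ g (length S) + g (length S)  ≡⟨ ∑-suc g (length S) ⟨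
  ∑ g (suc (length S))           ∎
  where
  open ≡-Reasoning
  countGreater-least : countGreater s₀ (s₀ ∷ S) ≡ length S
  countGreater-least rewrite dec-false (s₀ ℕ.<? s₀) (ℕP.<-irrefl refl) =
    countᵇ-all-true (All.map (λ {t} → dec-true (s₀ ℕ.<? t)) s₀<S)
  countGreater-cons : ∀ s → s ∈ S → countGreater s (s₀ ∷ S) ≡ countGreater s S
  countGreater-cons s s∈S rewrite dec-false (s ℕ.<? s₀) (ℕP.<⇒≯ (All.lookup s₀<S s∈S)) = refl
  first : f s₀ ≡ g (length S)
  first = trans (e s₀ (here refl)) (cong g countGreater-least)
  rest : sumℤ (map f S) ≡ ∑ g (length S)
  rest = sumℤ-by-countGreater sorted f g
           (λ s s∈S → trans (e s (there s∈S)) (cong g (countGreater-cons s s∈S)))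

sumℤ-by-countLess : ∀ {S} → AllPairs ℕ._<_ S → (f g : ℕ → ℤ) →
  (∀ s → s ∈ S → f s ≡ g (countLess s S)) → sumℤ (map f S) ≡ ∑ g (length S)
sumℤ-by-countLess [] f g e = refl
sumℤ-by-countLess {s₀ ∷ S} (s₀<S ∷ sorted) f g e = cong₂ _+_ first rest
  where
  countLess-least : countLess s₀ (s₀ ∷ S) ≡ 0
  countLess-least rewrite dec-false (s₀ ℕ.<? s₀) (ℕP.<-irrefl refl) =
    countᵇ-all-false (All.map (λ {t} s₀<t → dec-false (t ℕ.<? s₀) (ℕP.<⇒≯ s₀<t)) s₀<S)
  countLess-cons : ∀ s → s ∈ S → countLess s (s₀ ∷ S) ≡ suc (countLess s S)
  countLess-cons s s∈S rewrite dec-true (s₀ ℕ.<? s) (All.lookup s₀<S s∈S) = refl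
  first : f s₀ ≡ g 0
  first = trans (e s₀ (here refl)) (cong g countLess-least)
  rest : sumℤ (map f S) ≡ ∑ (g ∘ suc) (length S)
  rest = sumℤ-by-countLess sorted f (g ∘ suc)
           (λ s s∈S → trans (e s (there s∈S)) (cong g (countLess-cons s s∈S)))

cosCoef-suc : ∀ k → cosCoef (suc k) ≡ - sinCoef k
cosCoef-suc 0 = refl
cosCoef-suc 1 = refl
cosCoef-suc 2 = refl
cosCoef-suc 3 = refl
cosCoef-suc (suc (suc (suc (suc k)))) = cosCoef-suc k

sinCoef-suc : ∀ k → sinCoef (suc k) ≡ cosCoef k
sinCoef-suc 0 = refl
sinCoef-suc 1 = refl
sinCoef-suc 2 = refl
sinCoef-suc 3 = refl
sinCoef-suc (suc (suc (suc (suc k)))) = sinCoef-suc k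

cosPlusSin cosMinusSin : ℕ → ℤ
cosPlusSin  k = cosCoef k + sinCoef k
cosMinusSin k = cosCoef k - sinCoef k

cosPlusSin-suc : ∀ k → cosPlusSin (suc k) ≡ cosMinusSin k
cosPlusSin-suc k rewrite cosCoef-suc k | sinCoef-suc k = ℤP.+-comm (- sinCoef k) (cosCoef k)

cosMinusSin-suc : ∀ k → cosMinusSin (suc k) ≡ - cosPlusSin k
cosMinusSin-suc k rewrite cosCoef-suc k | sinCoef-suc k = negate (sinCoef k) (cosCoef k)
  where
  negate : ∀ s c → - s - c ≡ - (c + s)
  negate = solve-∀

module _ (x : ℤ) where

  xIf : Bool → ℤ
  xIf b = x ^ (if b then 1 else 0)

  wordSum : ℕ → List ℤ → ℤ → Bool → ℤ
  wordSum m L p even = sumℤ (map (λ w → x ^ altdesAux even p w) (distinctAbsWords m L))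

  wordSum-suc : ∀ m L p even → wordSum (suc m) L p even
    ≡ sumℤ (map (λ a → xIf (isAltDescentStep even p a)
                         * wordSum m (boolFilter (differentAbs a) L) a (not even)) L)
  wordSum-suc m L p even = begin
    sumℤ (map h (distinctAbsWords (suc m) L))
      ≡⟨ cong (sumℤ ∘ map h) (distinctAbsWords-suc m L) ⟩
    sumℤ (map h (concatMap (λ a → map (a ∷_) (words′ a)) L))
      ≡⟨ sumℤ-concatMap h _ L ⟩
    sumℤ (map (λ a → sumℤ (map h (map (a ∷_) (words′ a)))) L)
      ≡⟨ cong sumℤ (map-cong first-letter L) ⟩
    sumℤ (map (λ a → xIf (isAltDescentStep even p a) * wordSum m (boolFilter (differentAbs a) L) a (not even)) L) ∎
    where
    open ≡-Reasoning
    h : List ℤ → ℤ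
    h w = x ^ altdesAux even p w
    words′ : ℤ → List (List ℤ)
    words′ a = distinctAbsWords m (boolFilter (differentAbs a) L)
    bit : ℤ → ℕ
    bit a = if isAltDescentStep even p a then 1 else 0
    first-letter : ∀ a → sumℤ (map h (map (a ∷_) (words′ a)))
                       ≡ xIf (isAltDescentStep even p a) * wordSum m (boolFilter (differentAbs a) L) a (not even)
    first-letter a = begin
      sumℤ (map h (map (a ∷_) (words′ a)))
        ≡⟨ cong sumℤ (map-∘ (words′ a)) ⟨
      sumℤ (map (λ w → x ^ (bit a ℕ.+ altdesAux (not even) a w)) (words′ a))
        ≡⟨ cong sumℤ (map-cong (λ w → ℤP.^-distribˡ-+-* x (bit a) (altdesAux (not even) a w)) (words′ a)) ⟩
      sumℤ (map (λ w → xIf (isAltDescentStep even p a) * x ^ altdesAux (not even) a w) (words′ a))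
        ≡⟨ sumℤ-map-*ˡ (xIf (isAltDescentStep even p a)) _ (words′ a) ⟩
      xIf (isAltDescentStep even p a) * wordSum m (boolFilter (differentAbs a) L) a (not even) ∎

  wordSum-signedLetters-suc : ∀ m S p even → wordSum (suc m) (signedLetters S) p even ≡
      sumℤ (map (λ k → xIf (isAltDescentStep even p (+ suc k))
                         * wordSum m (signedLetters (remove k S)) (+ suc k) (not even)) S)
    + sumℤ (map (λ k → xIf (isAltDescentStep even p -[1+ k ])
                         * wordSum m (signedLetters (remove k S)) -[1+ k ] (not even)) S)
  wordSum-signedLetters-suc m S p even =
    trans (wordSum-suc m (signedLetters S) p even)
   (trans (cong sumℤ (map-++ G (map (λ k → + suc k) S) _))
   (trans (sumℤ-++ (map G (map (λ k → + suc k) S)) _)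
          (cong₂ _+_ (letters (λ k → + suc k) (λ k → refl)) (letters (λ k → -[1+ k ]) (λ k → refl)))))
    where
    G : ℤ → ℤ
    G a = xIf (isAltDescentStep even p a) * wordSum m (boolFilter (differentAbs a) (signedLetters S)) a (not even)
    letters : (f : ℕ → ℤ) → (∀ k → ∣ f k ∣ ≡ suc k) → sumℤ (map G (map f S))
            ≡ sumℤ (map (λ k → xIf (isAltDescentStep even p (f k))
                                 * wordSum m (signedLetters (remove k S)) (f k) (not even)) S)
    letters f abs-f = trans (cong sumℤ (sym (map-∘ S))) (cong sumℤ (map-cong
      (λ k → cong (λ L → xIf (isAltDescentStep even p (f k)) * wordSum m L (f k) (not even))
                  (boolFilter-differentAbs {f k} S (abs-f k))) S))

  -- m pairs ±s are unused, r of these 2m letters lie above the previous letter, whose position has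
  -- parity even.  The next letter is positive (first sum) or negative (second sum), and j counts
  -- the letters above it among those still unused after it.
  rankPoly : ℕ → ℕ → Bool → ℤ
  rankPoly zero    r even = 1ℤ
  rankPoly (suc m) r even =
      ∑ (λ j → xIf (isAltDescent even (does (j ℕ.<? r))) * rankPoly m j (not even)) (suc m)
    + ∑ (λ j → xIf (isAltDescent even (does (suc m ℕ.+ j ℕ.<? r))) * rankPoly m (m ℕ.+ j) (not even)) (suc m)

  wordSum≡rankPoly : ∀ m {S} p even → AllPairs ℕ._<_ S → length S ≡ m → p ∉ signedLetters S →
    wordSum m (signedLetters S) p even ≡ rankPoly m (countAbove p (signedLetters S)) even
  wordSum≡rankPoly zero    p even _ _ _ = refl
  wordSum≡rankPoly (suc m) {S} p even sorted |S| p∉ =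
    trans (wordSum-signedLetters-suc m S p even)
          (cong₂ _+_ (trans (sumℤ-by-countGreater sorted _ g₊ positive) (cong (∑ g₊) |S|))
                     (trans (sumℤ-by-countLess sorted _ g₋ negative) (cong (∑ g₋) |S|)))
    where
    r = countAbove p (signedLetters S)
    bit : ℕ → ℤ
    bit c = xIf (isAltDescent even (does (c ℕ.<? r)))
    g₊ g₋ : ℕ → ℤ
    g₊ j = bit j * rankPoly m j (not even)
    g₋ j = bit (suc m ℕ.+ j) * rankPoly m (m ℕ.+ j) (not even)
    |S∖s| : ∀ {s} → s ∈ S → length (remove s S) ≡ m
    |S∖s| s∈S = ℕP.suc-injective (trans (length-remove sorted s∈S) |S|)
    recurse : ∀ s a → s ∈ S → ∣ a ∣ ≡ suc s → wordSum m (signedLetters (remove s S)) a (not even)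
            ≡ rankPoly m (countAbove a (signedLetters (remove s S))) (not even)
    recurse s a s∈S abs-a = wordSum≡rankPoly m a (not even) (AllPairs-boolFilter _ sorted) (|S∖s| s∈S)
      (∉-signedLetters (λ t abs-a′ →
        subst (_∉ remove s S) (ℕP.suc-injective (trans (sym abs-a) abs-a′)) (∉-remove s S)))
    positive : ∀ s → s ∈ S →
        xIf (isAltDescentStep even p (+ suc s)) * wordSum m (signedLetters (remove s S)) (+ suc s) (not even)
      ≡ g₊ (countGreater s S)
    positive s s∈S = cong₂ _*_
      (cong xIf (trans (isAltDescentStep-by-rank even (pos-∈-signedLetters s∈S) p∉)
                       (cong (λ c → isAltDescent even (does (c ℕ.<? r))) (countAbove-pos s S))))
      (trans (recurse s (+ suc s) s∈S refl)
             (cong (λ c → rankPoly m c (not even)) (trans (countAbove-pos s (remove s S)) (countGreater-remove s S))))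
    negative : ∀ s → s ∈ S →
        xIf (isAltDescentStep even p -[1+ s ]) * wordSum m (signedLetters (remove s S)) -[1+ s ] (not even)
      ≡ g₋ (countLess s S)
    negative s s∈S = cong₂ _*_
      (cong xIf (trans (isAltDescentStep-by-rank even (neg-∈-signedLetters s∈S) p∉)
                       (cong (λ c → isAltDescent even (does (c ℕ.<? r)))
                             (trans (countAbove-neg s S) (cong (ℕ._+ countLess s S) |S|)))))
      (trans (recurse s -[1+ s ] s∈S refl)
             (cong (λ c → rankPoly m c (not even))
                   (trans (countAbove-neg s (remove s S)) (cong₂ ℕ._+_ (|S∖s| s∈S) (countLess-remove s S)))))

  -- Bhat n x unfolds to wordSum n (signedLetters (upTo n)) 0ℤ true.
  Bhat≡rankPoly : ∀ n → Bhat n x ≡ rankPoly n n true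
  Bhat≡rankPoly n =
    trans (wordSum≡rankPoly n 0ℤ true sorted (length-upTo n) (zero-∉-signedLetters (upTo n)))
          (cong (λ r → rankPoly n r true) (trans (countAbove-zero (upTo n)) (length-upTo n)))
    where
    sorted : AllPairs ℕ._<_ (upTo n)
    sorted = AllPairs.applyUpTo⁺₁ (λ k → k) n (λ i<j _ → i<j)

  -- Relations between A and B

  y : ℤ
  y = x - 1ℤ

  A B : ℕ → ℕ → ℤ
  A N r = rankPoly N r true
  B N r = rankPoly N r false

  thresholdSum : (ℕ → ℤ) → ℕ → ℕ → ℤ
  thresholdSum h r n = ∑ (λ j → xIf (does (j ℕ.<? r)) * h j) n

  thresholdSum-suc : ∀ h {r n} → r ℕ.< n → thresholdSum h (suc r) n ≡ thresholdSum h r n + y * h r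
  thresholdSum-suc h {zero}  {suc n} _ = split x (h 0) (∑ (λ j → 1ℤ * h (suc j)) n)
    where
    split : ∀ x a s → x * 1ℤ * a + s ≡ (1ℤ * a + s) + (x - 1ℤ) * a
    split = solve-∀
  thresholdSum-suc h {suc r} {suc n} (s≤s r<n) =
    trans (cong (_+_ (xIf true * h 0)) (thresholdSum-suc (h ∘ suc) r<n)) (sym (ℤP.+-assoc (xIf true * h 0) _ _))

  thresholdSum-beyond : ∀ h {r n} → n ℕ.≤ r → thresholdSum h (suc r) n ≡ thresholdSum h r n
  thresholdSum-beyond h {r} {n} n≤r = ∑-cong n (λ j j<n → cong (λ b → xIf b * h j)
    (trans (dec-true (j ℕ.<? suc r) (ℕP.m<n⇒m<1+n (ℕP.<-≤-trans j<n n≤r)))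
           (sym (dec-true (j ℕ.<? r) (ℕP.<-≤-trans j<n n≤r)))))

  thresholdSum-saturated : ∀ h {r n} → n ℕ.≤ r → thresholdSum h r n ≡ x * thresholdSum h 0 n
  thresholdSum-saturated h {r} {n} n≤r = trans
    (∑-cong n (λ j j<n → trans (cong (λ b → xIf b * h j) (dec-true (j ℕ.<? r) (ℕP.<-≤-trans j<n n≤r)))
                               (ℤP.*-assoc x 1ℤ (h j))))
    (∑-*ˡ x (λ j → 1ℤ * h j) n)

  A-split : ∀ m r →
    A (suc m) r ≡ thresholdSum (B m) r (suc m) + thresholdSum (B m ∘ (m ℕ.+_)) (r ∸ suc m) (suc m)
  A-split m r = cong (_+_ (thresholdSum (B m) r (suc m)))
    (∑-cong (suc m) (λ j _ → cong (λ b → xIf b * B m (m ℕ.+ j)) (does-+-<? (suc m) j r)))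

  A-suc-low : ∀ m {r} → r ℕ.< suc m → A (suc m) (suc r) ≡ A (suc m) r + y * B m r
  A-suc-low m {r} r<1+m = begin
    A (suc m) (suc r)
      ≡⟨ A-split m (suc r) ⟩
    thresholdSum (B m) (suc r) (suc m) + thresholdSum high (suc r ∸ suc m) (suc m)
      ≡⟨ cong₂ _+_ (thresholdSum-suc (B m) r<1+m) (cong (λ t → thresholdSum high t (suc m)) below) ⟩
    (thresholdSum (B m) r (suc m) + y * B m r) + thresholdSum high (r ∸ suc m) (suc m)
      ≡⟨ swap (thresholdSum (B m) r (suc m)) (y * B m r) (thresholdSum high (r ∸ suc m) (suc m)) ⟩
    (thresholdSum (B m) r (suc m) + thresholdSum high (r ∸ suc m) (suc m)) + y * B m r
      ≡⟨ cong (_+ y * B m r) (A-split m r) ⟨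
    A (suc m) r + y * B m r ∎
    where
    open ≡-Reasoning
    high = B m ∘ (m ℕ.+_)
    below : suc r ∸ suc m ≡ r ∸ suc m
    below = trans (ℕP.m≤n⇒m∸n≡0 (ℕ.s≤s⁻¹ r<1+m)) (sym (ℕP.m≤n⇒m∸n≡0 (ℕP.<⇒≤ r<1+m)))
    swap : ∀ a b c → (a + b) + c ≡ (a + c) + b
    swap = solve-∀

  A-suc-high : ∀ m {t} → t ℕ.< suc m →
    A (suc m) (suc (suc m ℕ.+ t)) ≡ A (suc m) (suc m ℕ.+ t) + y * B m (m ℕ.+ t)
  A-suc-high m {t} t<1+m = begin
    A (suc m) (suc (suc m ℕ.+ t))
      ≡⟨ A-split m (suc (suc m ℕ.+ t)) ⟩
    thresholdSum (B m) (suc (suc m ℕ.+ t)) (suc m) + thresholdSum high (suc (suc m ℕ.+ t) ∸ suc m) (suc m)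
      ≡⟨ cong₂ _+_ (thresholdSum-beyond (B m) (ℕP.m≤m+n (suc m) t))
                   (cong (λ u → thresholdSum high u (suc m)) (trans (cong (_∸ suc m) (sym (ℕP.+-suc (suc m) t)))
                                                                    (ℕP.m+n∸m≡n (suc m) (suc t)))) ⟩
    thresholdSum (B m) (suc m ℕ.+ t) (suc m) + thresholdSum high (suc t) (suc m)
      ≡⟨ cong (_+_ (thresholdSum (B m) (suc m ℕ.+ t) (suc m))) (thresholdSum-suc high t<1+m) ⟩
    thresholdSum (B m) (suc m ℕ.+ t) (suc m) + (thresholdSum high t (suc m) + y * high t)
      ≡⟨ cong (λ u → thresholdSum (B m) (suc m ℕ.+ t) (suc m) + (thresholdSum high u (suc m) + y * high t))
              (ℕP.m+n∸m≡n (suc m) t) ⟨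
    thresholdSum (B m) (suc m ℕ.+ t) (suc m) + (thresholdSum high (suc m ℕ.+ t ∸ suc m) (suc m) + y * high t)
      ≡⟨ ℤP.+-assoc (thresholdSum (B m) (suc m ℕ.+ t) (suc m))
                    (thresholdSum high (suc m ℕ.+ t ∸ suc m) (suc m)) (y * high t) ⟨
    (thresholdSum (B m) (suc m ℕ.+ t) (suc m) + thresholdSum high (suc m ℕ.+ t ∸ suc m) (suc m)) + y * high t
      ≡⟨ cong (_+ y * high t) (A-split m (suc m ℕ.+ t)) ⟨
    A (suc m) (suc m ℕ.+ t) + y * B m (m ℕ.+ t) ∎
    where
    open ≡-Reasoning
    high = B m ∘ (m ℕ.+_)

  A[N+N]≡x*A[0] : ∀ m → A (suc m) (suc m ℕ.+ suc m) ≡ x * A (suc m) 0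
  A[N+N]≡x*A[0] m = begin
    A (suc m) (N ℕ.+ N)
      ≡⟨ A-split m (N ℕ.+ N) ⟩
    thresholdSum (B m) (N ℕ.+ N) N + thresholdSum high (N ℕ.+ N ∸ N) N
      ≡⟨ cong₂ _+_ (thresholdSum-saturated (B m) (ℕP.m≤m+n N N))
                   (thresholdSum-saturated high (ℕP.≤-reflexive (sym (ℕP.m+n∸m≡n N N)))) ⟩
    x * thresholdSum (B m) 0 N + x * thresholdSum high 0 N
      ≡⟨ ℤP.*-distribˡ-+ x (thresholdSum (B m) 0 N) (thresholdSum high 0 N) ⟨
    x * A N 0 ∎
    where
    open ≡-Reasoning
    N = suc m
    high = B m ∘ (m ℕ.+_)

  -- Negating every letter reverses all comparisons: it exchanges the parities and sends rank r to 2N − r.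
  B≡A-reflect : ∀ N {r} → r ℕ.≤ N ℕ.+ N → B N r ≡ A N (N ℕ.+ N ∸ r)
  B≡A-reflect zero    _    = refl
  B≡A-reflect (suc m) {r} r≤2N = trans (ℤP.+-comm low high) (sym (cong₂ _+_ low-reflected high-reflected))
    where
    N  = suc m
    r* = N ℕ.+ N ∸ r
    low high : ℤ
    low  = ∑ (λ j → xIf (not (does (j ℕ.<? r))) * A m j) N
    high = ∑ (λ j → xIf (not (does (N ℕ.+ j ℕ.<? r))) * A m (m ℕ.+ j)) N
    r+r* : r ℕ.+ r* ≡ N ℕ.+ N
    r+r* = ℕP.m+[n∸m]≡n r≤2N
    B-reflect : ∀ k → k ℕ.≤ m ℕ.+ m → B m k ≡ A m (m ℕ.+ m ∸ k)
    B-reflect k k≤2m = B≡A-reflect m k≤2m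
    low-term : ∀ {j} → j ℕ.≤ m →
      xIf (does (m ∸ j ℕ.<? r*)) * B m (m ∸ j) ≡ xIf (not (does (N ℕ.+ j ℕ.<? r))) * A m (m ℕ.+ j)
    low-term {j} j≤m = cong₂ _*_
      (cong xIf (does-<?-complement r r* (m ∸ j) (N ℕ.+ j) (trans r+r* (cong suc (sym index-sum)))))
      (trans (B-reflect (m ∸ j) (ℕP.≤-trans (ℕP.m∸n≤m m j) (ℕP.m≤m+n m m)))
             (cong (A m) (trans (ℕP.+-∸-assoc m (ℕP.m∸n≤m m j)) (cong (m ℕ.+_) (ℕP.m∸[m∸n]≡n j≤m)))))
      where
      index-sum : (m ∸ j) ℕ.+ (N ℕ.+ j) ≡ m ℕ.+ N
      index-sum = trans (cong ((m ∸ j) ℕ.+_) (ℕP.+-comm N j))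
        (trans (sym (ℕP.+-assoc (m ∸ j) j N)) (cong (ℕ._+ N) (ℕP.m∸n+n≡m j≤m)))
    high-term : ∀ {j} → j ℕ.≤ m →
      xIf (does (N ℕ.+ (m ∸ j) ℕ.<? r*)) * B m (m ℕ.+ (m ∸ j)) ≡ xIf (not (does (j ℕ.<? r))) * A m j
    high-term {j} j≤m = cong₂ _*_
      (cong xIf (does-<?-complement r r* (N ℕ.+ (m ∸ j)) j (trans r+r* (cong suc (sym index-sum)))))
      (trans (B-reflect (m ℕ.+ (m ∸ j)) (ℕP.+-monoʳ-≤ m (ℕP.m∸n≤m m j)))
             (cong (A m) (trans (ℕP.[m+n]∸[m+o]≡n∸o m m (m ∸ j)) (ℕP.m∸[m∸n]≡n j≤m))))
      where
      index-sum : (N ℕ.+ (m ∸ j)) ℕ.+ j ≡ m ℕ.+ N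
      index-sum = trans (ℕP.+-assoc N (m ∸ j) j) (trans (cong (N ℕ.+_) (ℕP.m∸n+n≡m j≤m)) (ℕP.+-comm N m))
    low-reflected : ∑ (λ j → xIf (does (j ℕ.<? r*)) * B m j) N ≡ high
    low-reflected = trans (∑-reverse (λ j → xIf (does (j ℕ.<? r*)) * B m j) m)
                          (∑-cong N (λ j j<N → low-term (ℕ.s≤s⁻¹ j<N)))
    high-reflected : ∑ (λ j → xIf (does (N ℕ.+ j ℕ.<? r*)) * B m (m ℕ.+ j)) N ≡ low
    high-reflected = trans (∑-reverse (λ j → xIf (does (N ℕ.+ j ℕ.<? r*)) * B m (m ℕ.+ j)) m)
                           (∑-cong N (λ j j<N → high-term (ℕ.s≤s⁻¹ j<N)))

  -- Binomial closed form

  A-above-diagonal-suc : ∀ m {s} → s ℕ.≤ m →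
    A (suc m) (suc m ℕ.+ suc s) ≡ A (suc m) (suc m ℕ.+ s) + y * A m (m ∸ s)
  A-above-diagonal-suc m {s} s≤m = begin
    A (suc m) (suc m ℕ.+ suc s)             ≡⟨ cong (A (suc m)) (ℕP.+-suc (suc m) s) ⟩
    A (suc m) (suc (suc m ℕ.+ s))           ≡⟨ A-suc-high m (s≤s s≤m) ⟩
    A (suc m) (suc m ℕ.+ s) + y * B m (m ℕ.+ s)
      ≡⟨ cong (λ b → A (suc m) (suc m ℕ.+ s) + y * b) (B≡A-reflect m (ℕP.+-monoʳ-≤ m s≤m)) ⟩
    A (suc m) (suc m ℕ.+ s) + y * A m (m ℕ.+ m ∸ (m ℕ.+ s))
      ≡⟨ cong (λ k → A (suc m) (suc m ℕ.+ s) + y * A m k) (ℕP.[m+n]∸[m+o]≡n∸o m m s) ⟩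
    A (suc m) (suc m ℕ.+ s) + y * A m (m ∸ s) ∎
    where open ≡-Reasoning

  A-below-diagonal-suc : ∀ m {s} → s ℕ.≤ m →
    A (suc m) (suc m ∸ s) ≡ A (suc m) (m ∸ s) + y * A m (m ℕ.+ s)
  A-below-diagonal-suc m {s} s≤m = begin
    A (suc m) (suc m ∸ s)                   ≡⟨ cong (A (suc m)) (ℕP.+-∸-assoc 1 s≤m) ⟩
    A (suc m) (suc (m ∸ s))                 ≡⟨ A-suc-low m (s≤s (ℕP.m∸n≤m m s)) ⟩
    A (suc m) (m ∸ s) + y * B m (m ∸ s)
      ≡⟨ cong (λ b → A (suc m) (m ∸ s) + y * b)
              (B≡A-reflect m (ℕP.≤-trans (ℕP.m∸n≤m m s) (ℕP.m≤m+n m m))) ⟩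
    A (suc m) (m ∸ s) + y * A m (m ℕ.+ m ∸ (m ∸ s))
      ≡⟨ cong (λ k → A (suc m) (m ∸ s) + y * A m k)
              (trans (ℕP.+-∸-assoc m (ℕP.m∸n≤m m s)) (cong (m ℕ.+_) (ℕP.m∸[m∸n]≡n s≤m))) ⟩
    A (suc m) (m ∸ s) + y * A m (m ℕ.+ s) ∎
    where open ≡-Reasoning

  diagonal : ℕ → ℤ
  diagonal t = A t t

  twisted⁺ twisted⁻ : ℕ → ℕ → ℤ
  twisted⁺ N k = y ^ k * cosPlusSin k * diagonal (N ∸ k)
  twisted⁻ N k = y ^ k * cosMinusSin k * diagonal (N ∸ k)

  binomial⁺ binomial⁻ : ℕ → ℕ → ℤ
  binomial⁺ N s = ∑ (λ k → + (s C k) * twisted⁺ N k) (suc s)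
  binomial⁻ N s = ∑ (λ k → + (s C k) * twisted⁻ N k) (suc s)

  binomial⁺-suc : ∀ m s → binomial⁺ (suc m) (suc s) ≡ binomial⁺ (suc m) s + y * binomial⁻ m s
  binomial⁺-suc m s = trans (∑-Pascal s (twisted⁺ (suc m))) (cong (_+_ (binomial⁺ (suc m) s))
    (trans (∑-cong (suc s) (λ k _ → trans
             (cong (λ c → + (s C k) * (y * y ^ k * c * diagonal (m ∸ k))) (cosPlusSin-suc k))
             (factor (+ (s C k)) y (y ^ k) (cosMinusSin k) (diagonal (m ∸ k)))))
           (∑-*ˡ y (λ k → + (s C k) * twisted⁻ m k) (suc s))))
    where
    factor : ∀ c y Y q d → c * (y * Y * q * d) ≡ y * (c * (Y * q * d))
    factor = solve-∀

  binomial⁻-suc : ∀ m s → binomial⁻ (suc m) (suc s) ≡ binomial⁻ (suc m) s - y * binomial⁺ m s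
  binomial⁻-suc m s = trans (∑-Pascal s (twisted⁻ (suc m))) (trans (cong (_+_ (binomial⁻ (suc m) s))
    (trans (∑-cong (suc s) (λ k _ → trans
             (cong (λ c → + (s C k) * (y * y ^ k * c * diagonal (m ∸ k))) (cosMinusSin-suc k))
             (factor (+ (s C k)) y (y ^ k) (cosPlusSin k) (diagonal (m ∸ k)))))
           (∑-*ˡ (- y) (λ k → + (s C k) * twisted⁺ m k) (suc s))))
    (cong (_+_ (binomial⁻ (suc m) s)) (sym (ℤP.neg-distribˡ-* y (binomial⁺ m s)))))
    where
    factor : ∀ c y Y q d → c * (y * Y * (- q) * d) ≡ (- y) * (c * (Y * q * d))
    factor = solve-∀

  A-binomial : ∀ N s → s ℕ.≤ N → (A N (N ℕ.+ s) ≡ binomial⁺ N s) × (A N (N ∸ s) ≡ binomial⁻ N s)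
  A-binomial N       zero    _          = trans (cong (A N) (ℕP.+-identityʳ N)) (unit (A N N)) , unit (A N N)
    where
    unit : ∀ a → a ≡ 1ℤ * (1ℤ * 1ℤ * a) + 0ℤ
    unit = solve-∀
  A-binomial zero    (suc s) ()
  A-binomial (suc m) (suc s) (s≤s s≤m) = above , below
    where
    N = suc m
    IH-N = A-binomial N s (ℕP.m≤n⇒m≤1+n s≤m)
    IH-m = A-binomial m s s≤m
    above : A N (N ℕ.+ suc s) ≡ binomial⁺ N (suc s)
    above = begin
      A N (N ℕ.+ suc s)                  ≡⟨ A-above-diagonal-suc m s≤m ⟩
      A N (N ℕ.+ s) + y * A m (m ∸ s)    ≡⟨ cong₂ (λ a b → a + y * b) (proj₁ IH-N) (proj₂ IH-m) ⟩
      binomial⁺ N s + y * binomial⁻ m s  ≡⟨ binomial⁺-suc m s ⟨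
      binomial⁺ N (suc s)                ∎
      where open ≡-Reasoning
    below : A N (m ∸ s) ≡ binomial⁻ N (suc s)
    below = begin
      A N (m ∸ s)                            ≡⟨ move (A-below-diagonal-suc m s≤m) ⟩
      A N (N ∸ s) - y * A m (m ℕ.+ s)        ≡⟨ cong₂ (λ a b → a - y * b) (proj₂ IH-N) (proj₁ IH-m) ⟩
      binomial⁻ N s - y * binomial⁺ m s      ≡⟨ binomial⁻-suc m s ⟨
      binomial⁻ N (suc s)                    ∎
      where
      open ≡-Reasoning
      cancel : ∀ b c → b ≡ (b + c) - c
      cancel = solve-∀
      move : ∀ {a b c} → a ≡ b + c → b ≡ a - c
      move {b = b} {c} refl = cancel b c

  binomial⁺≡x*binomial⁻ : ∀ m → binomial⁺ (suc m) (suc m) ≡ x * binomial⁻ (suc m) (suc m)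
  binomial⁺≡x*binomial⁻ m = begin
    binomial⁺ N N   ≡⟨ proj₁ (A-binomial N N ℕP.≤-refl) ⟨
    A N (N ℕ.+ N)   ≡⟨ A[N+N]≡x*A[0] m ⟩
    x * A N 0       ≡⟨ cong (λ r → x * A N r) (ℕP.n∸n≡0 N) ⟨
    x * A N (N ∸ N) ≡⟨ cong (x *_) (proj₂ (A-binomial N N ℕP.≤-refl)) ⟩
    x * binomial⁻ N N ∎
    where
    open ≡-Reasoning
    N = suc m

  -- (x-1) cos_k - (x+1) sin_k = x (cos_k - sin_k) - (cos_k + sin_k).
  convolution-vanishes : ∀ m →
    ∑ (λ k → + (suc m C k) * diagonal (suc m ∸ k) * denomCoef k x) (suc (suc m)) ≡ 0ℤ
  convolution-vanishes m = begin
    ∑ (λ k → + (N C k) * diagonal (N ∸ k) * denomCoef k x) (suc N)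
      ≡⟨ ∑-cong (suc N) (λ k _ →
           regroup (+ (N C k)) ((x - 1ℤ) ^ k) (cosCoef k) (sinCoef k) (diagonal (N ∸ k)) x) ⟩
    ∑ (λ k → x * (+ (N C k) * twisted⁻ N k) + - 1ℤ * (+ (N C k) * twisted⁺ N k)) (suc N)
      ≡⟨ ∑-+ (λ k → x * (+ (N C k) * twisted⁻ N k)) (λ k → - 1ℤ * (+ (N C k) * twisted⁺ N k)) (suc N) ⟩
    ∑ (λ k → x * (+ (N C k) * twisted⁻ N k)) (suc N) + ∑ (λ k → - 1ℤ * (+ (N C k) * twisted⁺ N k)) (suc N)
      ≡⟨ cong₂ _+_ (∑-*ˡ x (λ k → + (N C k) * twisted⁻ N k) (suc N))
                   (∑-*ˡ (- 1ℤ) (λ k → + (N C k) * twisted⁺ N k) (suc N)) ⟩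
    x * binomial⁻ N N + - 1ℤ * binomial⁺ N N
      ≡⟨ cong (λ b → x * binomial⁻ N N + - 1ℤ * b) (binomial⁺≡x*binomial⁻ m) ⟩
    x * binomial⁻ N N + - 1ℤ * (x * binomial⁻ N N)
      ≡⟨ cancel (x * binomial⁻ N N) ⟩
    0ℤ ∎
    where
    open ≡-Reasoning
    N = suc m
    regroup : ∀ c Y co si d x → c * d * ((x - 1ℤ) * Y * co - (x + 1ℤ) * Y * si)
            ≡ x * (c * (Y * (co - si) * d)) + - 1ℤ * (c * (Y * (co + si) * d))
    regroup = solve-∀
    cancel : ∀ a → a + - 1ℤ * a ≡ 0ℤ
    cancel = solve-∀

mainTheorem5 : (x : ℤ) → (n : ℕ) → prodCoef n x ≡ numCoef n x
mainTheorem5 x zero    = constant-term x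
  where
  constant-term : ∀ x → 1ℤ * 1ℤ * ((x - 1ℤ) * 1ℤ * 1ℤ - (x + 1ℤ) * 1ℤ * 0ℤ) + 0ℤ ≡ x - 1ℤ
  constant-term = solve-∀
mainTheorem5 x (suc m) = begin
  prodCoef N x
    ≡⟨ sumℤ-applyUpTo term (λ k → k) (suc N) ⟩
  ∑ term (suc N)
    ≡⟨ ∑-reverse term N ⟩
  ∑ (λ j → term (N ∸ j)) (suc N)
    ≡⟨ ∑-cong (suc N) (λ j j<1+N → reflected-term (ℕ.s≤s⁻¹ j<1+N)) ⟩
  ∑ (λ k → + (N C k) * diagonal x (N ∸ k) * denomCoef k x) (suc N)
    ≡⟨ convolution-vanishes x m ⟩
  0ℤ ∎
  where
  open ≡-Reasoning
  N = suc m
  term : ℕ → ℤ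
  term k = + (N C k) * Bhat k x * denomCoef (N ∸ k) x
  reflected-term : ∀ {j} → j ℕ.≤ N → term (N ∸ j) ≡ + (N C j) * diagonal x (N ∸ j) * denomCoef j x
  reflected-term {j} j≤N = cong₂ _*_
    (cong₂ (λ c b → + c * b) (sym (nCk≡nC[n∸k] j≤N)) (Bhat≡rankPoly x (N ∸ j)))
    (cong (λ k → denomCoef k x) (ℕP.m∸[m∸n]≡n j≤N))
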